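{- Let $(a_n)_{n \ge 0}$ be the sequence of rational numbers defined by $a_0 = 0$ and $a_n = \frac{n}{2} a_{n-1} + (n-1)!$ for all $n \geq 1$. Then for every natural number $n$, $$a_n = (-1)^{n-1} \sum_{k=0}^{n} G_k\, s(n,k),$$ where $G_k$ are the Genocchi numbers and $s(n,k)$ are the Stirling numbers of the first kind.
   Context: The Stirling numbers of the first kind $s(n,k)$ ($0 \le k \le n$) are the (signed) integers defined by the polynomial identity $X(X-1)\cdots(X-n+1) = \sum_{k=0}^{n} s(n,k) X^k$. The Genocchi numbers $G_n$ ($n \ge 0$) are defined by the exponential generating function $\frac{2x}{e^x+1} = \sum_{n=0}^{\infty} G_n \frac{x^n}{n!}$. -}

module Defs where

open import Data.Nat as ℕ using (ℕ; zero; suc; _!)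
open import Data.Nat.Properties using (_!≢0)
open import Data.Integer as ℤ using (ℤ; +_)
open import Data.Rational using (ℚ; _+_; _*_; _-_; -_; _/_; 0ℚ; 1ℚ)

sumTo : ℕ → (ℕ → ℚ) → ℚ
sumTo zero    f = 0ℚ
sumTo (suc n) f = sumTo n f + f n

-- Signed Stirling numbers of the first kind, as the coefficients of the
-- falling factorial polynomial  X(X-1)...(X-n+1).
-- fallingCoeff n k = coefficient of X^k in X(X-1)...(X-n+1);  the step
-- n ↦ suc n multiplies the polynomial by (X - n).
fallingCoeff : ℕ → ℕ → ℤ
fallingCoeff zero    zero    = + 1
fallingCoeff zero    (suc k) = + 0
fallingCoeff (suc n) zero    = ℤ.- (+ n ℤ.* fallingCoeff n zero)
fallingCoeff (suc n) (suc k) = fallingCoeff n k ℤ.- (+ n ℤ.* fallingCoeff n (suc k))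

stirling1 : ℕ → ℕ → ℤ
stirling1 = fallingCoeff

PowerSeries : Set
PowerSeries = ℕ → ℚ

_⊛_ : PowerSeries → PowerSeries → PowerSeries
(f ⊛ g) n = sumTo (suc n) (λ k → f k * g (n ℕ.∸ k))

_⊕_ : PowerSeries → PowerSeries → PowerSeries
(f ⊕ g) n = f n + g n

invFact : ℕ → ℚ
invFact m = (+ 1 / (m !)) {{m !≢0}}

expSeries : PowerSeries
expSeries = invFact

oneSeries : PowerSeries
oneSeries zero    = 1ℚ
oneSeries (suc n) = 0ℚ

twoX : PowerSeries
twoX (suc zero) = (+ 2) / 1
twoX _          = 0ℚ

egf : (ℕ → ℚ) → PowerSeries
egf a n = a n * invFact n

-- G is the Genocchi sequence: its EGF F satisfies (e^x + 1) F(x) = 2x,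
-- i.e. F = 2x / (e^x + 1) (e^x + 1 is invertible in ℚ[[x]]).
IsGenocchi : (ℕ → ℚ) → Set
IsGenocchi G = ∀ n → ((expSeries ⊕ oneSeries) ⊛ egf G) n ≡ twoX n
  where open import Relation.Binary.PropositionalEquality using (_≡_)

seqA : ℕ → ℚ
seqA zero    = 0ℚ
seqA (suc n) = ((+ suc n) / 2) * seqA n + (+ (n !)) / 1

-- (-1)^(n-1) as a rational number, with (-1)^(-1) = -1 for n = 0.
signPred : ℕ → ℚ
signPred zero    = - 1ℚ
signPred (suc n) = ((ℤ.- (+ 1)) ℤ.^ n) / 1

toℚ : ℤ → ℚ
toℚ z = z / 1

-- Write B F n = Σₖ F k s(n,k). The recurrence of the Stirling numbers gives
-- B F (n+1) = B (F ∘ suc) n − n B F n, and applying it to the binomial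
-- transform H G k = Σⱼ C(k,j) G j (the umbral form of
-- (1+t)(1+t−1)⋯(1+t−n) = (1+t) t(t−1)⋯(t−n+1)) gives
-- B (H G) (n+1) = B (G ∘ suc) n + B G n. For the Genocchi numbers the
-- generating function identity says H G n + G n = 2[n = 1], so
-- B (H G) (n+1) + B G (n+1) = 2 s(n+1,1) = 2 (−1)ⁿ n!. Eliminating
-- B (G ∘ suc) n between these identities leaves
-- B G (n+1) = (−1)ⁿ n! − ((n+1)/2) B G n, which is the recurrence of aₙ.
module Submission where

open import Defs
open import Data.Integer as ℤ using (ℤ; +_)
import Data.Integer.Properties as ℤP
import Data.Integer.Tactic.RingSolver as ℤ-Solver
open import Data.Nat as ℕ using (ℕ; zero; suc; _∸_; _!; _<_; _≤_; s≤s; NonZero)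
open import Data.Nat.Combinatorics using (_C_; nCk≡nC[n∸k]; nCk+nC[k+1]≡[n+1]C[k+1]; k![n∸k]!∣n!)
open import Data.Nat.Combinatorics.Specification using (nCk≡n!/k![n-k]!; k>n⇒nCk≡0)
open import Data.Nat.DivMod using (m/n*n≡m)
open import Data.Nat.Properties using (_!≢0; _!*_!≢0; ≤-refl; m<n⇒m<1+n)
open import Data.Rational as ℚ using (ℚ; _+_; _*_; _-_; -_; _/_; 0ℚ; 1ℚ; ½)
open import Data.Rational.Properties
  using ( _≟_; +-*-commutativeRing; toℚᵘ-injective; toℚᵘ-fromℚᵘ; fromℚᵘ-cong
        ; toℚᵘ-homo-+; toℚᵘ-homo-*; toℚᵘ-homo‿-; +-assoc; +-comm; +-identityˡ; +-identityʳ
        ; *-identityˡ; *-identityʳ; *-zeroˡ; *-zeroʳ; *-distribˡ-+; *-distribʳ-+ )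
open import Data.Rational.Unnormalised as ℚᵘ using (ℚᵘ; mkℚᵘ; *≡*)
import Data.Rational.Unnormalised.Properties as ℚᵘ
open import Function.Base using (_∘_)
open import Level using (0ℓ)
open import Relation.Binary.PropositionalEquality
open import Relation.Nullary.Decidable.Core using (dec⇒maybe)
open import Tactic.RingSolver using (solve-∀)
import Tactic.RingSolver.Core.AlmostCommutativeRing as ACR

open ≡-Reasoning

ℚ-ring : ACR.AlmostCommutativeRing 0ℓ 0ℓ
ℚ-ring = ACR.fromCommutativeRing +-*-commutativeRing (λ x → dec⇒maybe (0ℚ ≟ x))

fromℚᵘ-homo-+ : ∀ p q → ℚ.fromℚᵘ (p ℚᵘ.+ q) ≡ ℚ.fromℚᵘ p + ℚ.fromℚᵘ q
fromℚᵘ-homo-+ p q = toℚᵘ-injective (ℚᵘ.≃-trans (toℚᵘ-fromℚᵘ (p ℚᵘ.+ q))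
  (ℚᵘ.≃-sym (ℚᵘ.≃-trans (toℚᵘ-homo-+ (ℚ.fromℚᵘ p) (ℚ.fromℚᵘ q))
    (ℚᵘ.+-cong (toℚᵘ-fromℚᵘ p) (toℚᵘ-fromℚᵘ q)))))

fromℚᵘ-homo-* : ∀ p q → ℚ.fromℚᵘ (p ℚᵘ.* q) ≡ ℚ.fromℚᵘ p * ℚ.fromℚᵘ q
fromℚᵘ-homo-* p q = toℚᵘ-injective (ℚᵘ.≃-trans (toℚᵘ-fromℚᵘ (p ℚᵘ.* q))
  (ℚᵘ.≃-sym (ℚᵘ.≃-trans (toℚᵘ-homo-* (ℚ.fromℚᵘ p) (ℚ.fromℚᵘ q))
    (ℚᵘ.*-cong (toℚᵘ-fromℚᵘ p) (toℚᵘ-fromℚᵘ q)))))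

fromℚᵘ-homo‿- : ∀ p → ℚ.fromℚᵘ (ℚᵘ.- p) ≡ - ℚ.fromℚᵘ p
fromℚᵘ-homo‿- p = toℚᵘ-injective (ℚᵘ.≃-trans (toℚᵘ-fromℚᵘ (ℚᵘ.- p))
  (ℚᵘ.≃-sym (ℚᵘ.≃-trans (toℚᵘ-homo‿- (ℚ.fromℚᵘ p)) (ℚᵘ.-‿cong (toℚᵘ-fromℚᵘ p)))))

-- toℚ a is definitionally ℚ.fromℚᵘ (ι a).
ι : ℤ → ℚᵘ
ι a = mkℚᵘ a 0

ι-homo-+ : ∀ a b → ι (a ℤ.+ b) ℚᵘ.≃ ι a ℚᵘ.+ ι b
ι-homo-+ a b = *≡* (identity a b)
  where
  identity : ∀ a b → (a ℤ.+ b) ℤ.* (+ 1 ℤ.* + 1) ≡ (a ℤ.* + 1 ℤ.+ b ℤ.* + 1) ℤ.* + 1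
  identity = ℤ-Solver.solve-∀

ι-homo-* : ∀ a b → ι (a ℤ.* b) ℚᵘ.≃ ι a ℚᵘ.* ι b
ι-homo-* a b = *≡* (identity a b)
  where
  identity : ∀ a b → (a ℤ.* b) ℤ.* (+ 1 ℤ.* + 1) ≡ (a ℤ.* b) ℤ.* + 1
  identity = ℤ-Solver.solve-∀

toℚ-homo-+ : ∀ a b → toℚ (a ℤ.+ b) ≡ toℚ a + toℚ b
toℚ-homo-+ a b = trans (fromℚᵘ-cong (ι-homo-+ a b)) (fromℚᵘ-homo-+ (ι a) (ι b))

toℚ-homo-* : ∀ a b → toℚ (a ℤ.* b) ≡ toℚ a * toℚ b
toℚ-homo-* a b = trans (fromℚᵘ-cong (ι-homo-* a b)) (fromℚᵘ-homo-* (ι a) (ι b))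

toℚ-homo‿- : ∀ a → toℚ (ℤ.- a) ≡ - toℚ a
toℚ-homo‿- a = fromℚᵘ-homo‿- (ι a)

fromℕ : ℕ → ℚ
fromℕ n = toℚ (+ n)

fromℕ-suc : ∀ n → fromℕ (suc n) ≡ 1ℚ + fromℕ n
fromℕ-suc n = trans (cong toℚ (ℤP.pos-+ 1 n)) (toℚ-homo-+ (+ 1) (+ n))

fromℕ-homo-* : ∀ m n → fromℕ (m ℕ.* n) ≡ fromℕ m * fromℕ n
fromℕ-homo-* m n = trans (cong toℚ (ℤP.pos-* m n)) (toℚ-homo-* (+ m) (+ n))

a/n≡a*1/n : ∀ a n .{{_ : NonZero n}} → a / n ≡ toℚ a * (+ 1 / n)
a/n≡a*1/n a (suc n) =
  trans (fromℚᵘ-cong {mkℚᵘ a n} {ι a ℚᵘ.* mkℚᵘ (+ 1) n} (*≡* (identity a (+ suc n))))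
        (fromℚᵘ-homo-* (ι a) (mkℚᵘ (+ 1) n))
  where
  identity : ∀ a d → a ℤ.* (+ 1 ℤ.* d) ≡ (a ℤ.* + 1) ℤ.* d
  identity = ℤ-Solver.solve-∀

1/n*n≡1 : ∀ n .{{_ : NonZero n}} → (+ 1 / n) * fromℕ n ≡ 1ℚ
1/n*n≡1 (suc n) =
  trans (sym (fromℚᵘ-homo-* (mkℚᵘ (+ 1) n) (ι (+ suc n))))
        (fromℚᵘ-cong {mkℚᵘ (+ 1) n ℚᵘ.* ι (+ suc n)} {ι (+ 1)} (*≡* (identity (+ suc n))))
  where
  identity : ∀ d → (+ 1 ℤ.* d) ℤ.* + 1 ≡ + 1 ℤ.* (d ℤ.* + 1)
  identity = ℤ-Solver.solve-∀

invFact-inverse : ∀ n → invFact n * fromℕ (n !) ≡ 1ℚ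
invFact-inverse n = 1/n*n≡1 (n !) {{n !≢0}}

sumTo-cong : ∀ m {f g : ℕ → ℚ} → (∀ k → f k ≡ g k) → sumTo m f ≡ sumTo m g
sumTo-cong zero    f≗g = refl
sumTo-cong (suc m) f≗g = cong₂ _+_ (sumTo-cong m f≗g) (f≗g m)

sumTo-cong-< : ∀ m {f g : ℕ → ℚ} → (∀ {k} → k < m → f k ≡ g k) → sumTo m f ≡ sumTo m g
sumTo-cong-< zero    f≗g = refl
sumTo-cong-< (suc m) f≗g = cong₂ _+_ (sumTo-cong-< m (f≗g ∘ m<n⇒m<1+n)) (f≗g ≤-refl)

sumTo-+ : ∀ m (f g : ℕ → ℚ) → sumTo m (λ k → f k + g k) ≡ sumTo m f + sumTo m g
sumTo-+ zero    f g = refl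
sumTo-+ (suc m) f g =
  trans (cong (_+ (f m + g m)) (sumTo-+ m f g)) (interchange (sumTo m f) (sumTo m g) (f m) (g m))
  where
  interchange : ∀ a b c d → (a + b) + (c + d) ≡ (a + c) + (b + d)
  interchange = solve-∀ ℚ-ring

sumTo-- : ∀ m (f g : ℕ → ℚ) → sumTo m (λ k → f k - g k) ≡ sumTo m f - sumTo m g
sumTo-- zero    f g = refl
sumTo-- (suc m) f g =
  trans (cong (_+ (f m - g m)) (sumTo-- m f g)) (interchange (sumTo m f) (sumTo m g) (f m) (g m))
  where
  interchange : ∀ a b c d → (a - b) + (c - d) ≡ (a + c) - (b + d)
  interchange = solve-∀ ℚ-ring

sumTo-* : ∀ m c (f : ℕ → ℚ) → sumTo m (λ k → c * f k) ≡ c * sumTo m f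
sumTo-* zero    c f = sym (*-zeroʳ c)
sumTo-* (suc m) c f =
  trans (cong (_+ c * f m) (sumTo-* m c f)) (sym (*-distribˡ-+ c (sumTo m f) (f m)))

sumTo-sucˡ : ∀ m (f : ℕ → ℚ) → sumTo (suc m) f ≡ f 0 + sumTo m (f ∘ suc)
sumTo-sucˡ zero    f = trans (+-identityˡ (f 0)) (sym (+-identityʳ (f 0)))
sumTo-sucˡ (suc m) f =
  trans (cong (_+ f (suc m)) (sumTo-sucˡ m f)) (+-assoc (f 0) (sumTo m (f ∘ suc)) (f (suc m)))

sumTo-reverse : ∀ n (f : ℕ → ℚ) → sumTo (suc n) f ≡ sumTo (suc n) (λ k → f (n ∸ k))
sumTo-reverse zero    f = refl
sumTo-reverse (suc n) f = begin
  sumTo (suc n) f + f (suc n)                   ≡⟨ cong (_+ f (suc n)) (sumTo-reverse n f) ⟩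
  sumTo (suc n) (λ k → f (n ∸ k)) + f (suc n)   ≡⟨ +-comm _ (f (suc n)) ⟩
  f (suc n) + sumTo (suc n) (λ k → f (n ∸ k))   ≡⟨ sumTo-sucˡ (suc n) (λ k → f (suc n ∸ k)) ⟨
  sumTo (suc (suc n)) (λ k → f (suc n ∸ k))     ∎

nCk*[k!*[n∸k]!]≡n! : ∀ {n k} → k ≤ n → (n C k) ℕ.* (k ! ℕ.* (n ∸ k) !) ≡ n !
nCk*[k!*[n∸k]!]≡n! {n} {k} k≤n =
  trans (cong (ℕ._* (k ! ℕ.* (n ∸ k) !)) (nCk≡n!/k![n-k]! k≤n))
        (m/n*n≡m {{k !* (n ∸ k) !≢0}} (k![n∸k]!∣n! k≤n))

fromℕ-nCk : ∀ {n k} → k ≤ n → fromℕ (n C k) ≡ fromℕ (n !) * (invFact k * invFact (n ∸ k))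
fromℕ-nCk {n} {k} k≤n = begin
  c
    ≡⟨ *-identityʳ c ⟨
  c * (1ℚ * 1ℚ)
    ≡⟨ cong₂ (λ u v → c * (u * v)) (invFact-inverse k) (invFact-inverse (n ∸ k)) ⟨
  c * ((i * fromℕ (k !)) * (j * fromℕ ((n ∸ k) !)))
    ≡⟨ regroup c (fromℕ (k !)) (fromℕ ((n ∸ k) !)) i j ⟨
  c * (fromℕ (k !) * fromℕ ((n ∸ k) !)) * (i * j)
    ≡⟨ cong (_* (i * j)) (trans (fromℕ-homo-* (n C k) _) (cong (c *_) (fromℕ-homo-* (k !) _))) ⟨
  fromℕ ((n C k) ℕ.* (k ! ℕ.* (n ∸ k) !)) * (i * j)
    ≡⟨ cong (λ m → fromℕ m * (i * j)) (nCk*[k!*[n∸k]!]≡n! k≤n) ⟩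
  fromℕ (n !) * (i * j) ∎
  where
  c = fromℕ (n C k)
  i = invFact k
  j = invFact (n ∸ k)
  regroup : ∀ c a b i j → c * (a * b) * (i * j) ≡ c * ((i * a) * (j * b))
  regroup = solve-∀ ℚ-ring

binomialTransform : (ℕ → ℚ) → ℕ → ℚ
binomialTransform G n = sumTo (suc n) (λ j → fromℕ (n C j) * G j)

binomialTransform-zero : ∀ G → binomialTransform G 0 ≡ G 0
binomialTransform-zero G = trans (+-identityˡ _) (*-identityˡ (G 0))

binomialTransform-suc : ∀ G n →
  binomialTransform G (suc n) ≡ binomialTransform (G ∘ suc) n + binomialTransform G n
binomialTransform-suc G n = begin
  binomialTransform G (suc n)
    ≡⟨ sumTo-sucˡ (suc n) _ ⟩
  fromℕ 1 * G 0 + sumTo (suc n) (λ j → fromℕ (suc n C suc j) * G (suc j))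
    ≡⟨ cong (_+_ (fromℕ 1 * G 0)) (trans (sumTo-cong (suc n) pascal) (sumTo-+ (suc n) _ _)) ⟩
  fromℕ 1 * G 0 + (binomialTransform (G ∘ suc) n + T)
    ≡⟨ swap (fromℕ 1 * G 0) (binomialTransform (G ∘ suc) n) T ⟩
  binomialTransform (G ∘ suc) n + (fromℕ 1 * G 0 + T)
    ≡⟨ cong (_+_ (binomialTransform (G ∘ suc) n)) extended ⟨
  binomialTransform (G ∘ suc) n + binomialTransform G n ∎
  where
  T = sumTo (suc n) (λ j → fromℕ (n C suc j) * G (suc j))
  pascal : ∀ j → fromℕ (suc n C suc j) * G (suc j)
                 ≡ fromℕ (n C j) * G (suc j) + fromℕ (n C suc j) * G (suc j)
  pascal j = begin
    fromℕ (suc n C suc j) * G (suc j)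
      ≡⟨ cong (λ m → toℚ m * G (suc j))
           (trans (cong +_ (sym (nCk+nC[k+1]≡[n+1]C[k+1] n j))) (ℤP.pos-+ (n C j) (n C suc j))) ⟩
    toℚ (+ (n C j) ℤ.+ + (n C suc j)) * G (suc j)
      ≡⟨ cong (_* G (suc j)) (toℚ-homo-+ (+ (n C j)) (+ (n C suc j))) ⟩
    (fromℕ (n C j) + fromℕ (n C suc j)) * G (suc j)
      ≡⟨ *-distribʳ-+ (G (suc j)) (fromℕ (n C j)) (fromℕ (n C suc j)) ⟩
    fromℕ (n C j) * G (suc j) + fromℕ (n C suc j) * G (suc j) ∎
  extended : binomialTransform G n ≡ fromℕ 1 * G 0 + T
  extended = begin
    binomialTransform G n
      ≡⟨ +-identityʳ _ ⟨
    binomialTransform G n + 0ℚ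
      ≡⟨ cong (_+_ (binomialTransform G n))
           (trans (cong (λ m → fromℕ m * G (suc n)) (k>n⇒nCk≡0 {n} ≤-refl)) (*-zeroˡ (G (suc n)))) ⟨
    sumTo (suc (suc n)) (λ j → fromℕ (n C j) * G j)
      ≡⟨ sumTo-sucˡ (suc n) _ ⟩
    fromℕ 1 * G 0 + T ∎
  swap : ∀ a b c → a + (b + c) ≡ b + (a + c)
  swap = solve-∀ ℚ-ring

⊛-distribʳ-⊕ : ∀ f g h n → ((f ⊕ g) ⊛ h) n ≡ (f ⊛ h) n + (g ⊛ h) n
⊛-distribʳ-⊕ f g h n =
  trans (sumTo-cong (suc n) (λ k → *-distribʳ-+ (h (n ∸ k)) (f k) (g k))) (sumTo-+ (suc n) _ _)

oneSeries-⊛ : ∀ f n → (oneSeries ⊛ f) n ≡ f n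
oneSeries-⊛ f n = begin
  (oneSeries ⊛ f) n
    ≡⟨ sumTo-sucˡ n _ ⟩
  1ℚ * f n + sumTo n (λ k → 0ℚ * f (n ∸ suc k))
    ≡⟨ cong₂ _+_ (*-identityˡ (f n)) (trans (sumTo-* n 0ℚ f′) (*-zeroˡ (sumTo n f′))) ⟩
  f n + 0ℚ
    ≡⟨ +-identityʳ (f n) ⟩
  f n ∎
  where
  f′ = λ k → f (n ∸ suc k)

n!*egf≡id : ∀ G n → fromℕ (n !) * egf G n ≡ G n
n!*egf≡id G n = begin
  fromℕ (n !) * (G n * invFact n)  ≡⟨ rearrange (fromℕ (n !)) (G n) (invFact n) ⟩
  G n * (invFact n * fromℕ (n !))  ≡⟨ cong (G n *_) (invFact-inverse n) ⟩
  G n * 1ℚ                         ≡⟨ *-identityʳ (G n) ⟩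
  G n                              ∎
  where
  rearrange : ∀ f g i → f * (g * i) ≡ g * (i * f)
  rearrange = solve-∀ ℚ-ring

n!*[expSeries⊛egf]≡binomialTransform : ∀ G n →
  fromℕ (n !) * (expSeries ⊛ egf G) n ≡ binomialTransform G n
n!*[expSeries⊛egf]≡binomialTransform G n = begin
  fromℕ (n !) * sumTo (suc n) (λ k → invFact k * egf G (n ∸ k))
    ≡⟨ sumTo-* (suc n) (fromℕ (n !)) _ ⟨
  sumTo (suc n) (λ k → fromℕ (n !) * (invFact k * egf G (n ∸ k)))
    ≡⟨ sumTo-cong-< (suc n) term ⟩
  sumTo (suc n) (λ k → fromℕ (n C (n ∸ k)) * G (n ∸ k))
    ≡⟨ sumTo-reverse n (λ j → fromℕ (n C j) * G j) ⟨
  binomialTransform G n ∎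
  where
  term : ∀ {k} → k < suc n →
         fromℕ (n !) * (invFact k * egf G (n ∸ k)) ≡ fromℕ (n C (n ∸ k)) * G (n ∸ k)
  term {k} (s≤s k≤n) = begin
    fromℕ (n !) * (invFact k * (G (n ∸ k) * invFact (n ∸ k)))
      ≡⟨ rearrange (fromℕ (n !)) (invFact k) (G (n ∸ k)) (invFact (n ∸ k)) ⟩
    fromℕ (n !) * (invFact k * invFact (n ∸ k)) * G (n ∸ k)
      ≡⟨ cong (_* G (n ∸ k)) (fromℕ-nCk k≤n) ⟨
    fromℕ (n C k) * G (n ∸ k)
      ≡⟨ cong (λ m → fromℕ m * G (n ∸ k)) (nCk≡nC[n∸k] k≤n) ⟩
    fromℕ (n C (n ∸ k)) * G (n ∸ k) ∎
    where
    rearrange : ∀ f i g j → f * (i * (g * j)) ≡ f * (i * j) * g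
    rearrange = solve-∀ ℚ-ring

n!*twoX≡twoX : ∀ n → fromℕ (n !) * twoX n ≡ twoX n
n!*twoX≡twoX zero          = refl
n!*twoX≡twoX (suc zero)    = refl
n!*twoX≡twoX (suc (suc n)) = *-zeroʳ (fromℕ (suc (suc n) !))

binomialTransform-genocchi : ∀ G → IsGenocchi G → ∀ n → binomialTransform G n + G n ≡ twoX n
binomialTransform-genocchi G isG n = begin
  binomialTransform G n + G n
    ≡⟨ cong₂ _+_ (n!*[expSeries⊛egf]≡binomialTransform G n)
                 (trans (cong (f *_) (oneSeries-⊛ (egf G) n)) (n!*egf≡id G n)) ⟨
  f * (expSeries ⊛ egf G) n + f * (oneSeries ⊛ egf G) n
    ≡⟨ *-distribˡ-+ f _ _ ⟨
  f * ((expSeries ⊛ egf G) n + (oneSeries ⊛ egf G) n)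
    ≡⟨ cong (f *_) (⊛-distribʳ-⊕ expSeries oneSeries (egf G) n) ⟨
  f * ((expSeries ⊕ oneSeries) ⊛ egf G) n
    ≡⟨ cong (f *_) (isG n) ⟩
  f * twoX n
    ≡⟨ n!*twoX≡twoX n ⟩
  twoX n ∎
  where
  f = fromℕ (n !)

genocchi-zero : ∀ G → IsGenocchi G → G 0 ≡ 0ℚ
genocchi-zero G isG = begin
  G 0                                 ≡⟨ half-double (G 0) ⟨
  ½ * (G 0 + G 0)                     ≡⟨ cong (λ b → ½ * (b + G 0)) (binomialTransform-zero G) ⟨
  ½ * (binomialTransform G 0 + G 0)   ≡⟨ cong (½ *_) (binomialTransform-genocchi G isG 0) ⟩
  ½ * 0ℚ                              ≡⟨⟩
  0ℚ                                  ∎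
  where
  half-double : ∀ x → ½ * (x + x) ≡ x
  half-double = solve-∀ ℚ-ring

s : ℕ → ℕ → ℚ
s n k = toℚ (stirling1 n k)

s⁻ : ℕ → ℕ → ℚ
s⁻ n zero    = 0ℚ
s⁻ n (suc k) = s n k

toℚ[-n*a]≡-[n*a] : ∀ n a → toℚ (ℤ.- (+ n ℤ.* a)) ≡ - (fromℕ n * toℚ a)
toℚ[-n*a]≡-[n*a] n a = trans (toℚ-homo‿- (+ n ℤ.* a)) (cong -_ (toℚ-homo-* (+ n) a))

s-suc : ∀ n k → s (suc n) k ≡ s⁻ n k - fromℕ n * s n k
s-suc n zero    = trans (toℚ[-n*a]≡-[n*a] n (stirling1 n 0)) (sym (+-identityˡ _))
s-suc n (suc k) = trans (toℚ-homo-+ (stirling1 n k) _)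
                        (cong (_+_ (s n k)) (toℚ[-n*a]≡-[n*a] n (stirling1 n (suc k))))

n<k⇒fallingCoeff≡0 : ∀ {n k} → n < k → fallingCoeff n k ≡ + 0
n<k⇒fallingCoeff≡0 {zero}  {suc k} _ = refl
n<k⇒fallingCoeff≡0 {suc n} {suc k} (s≤s n<k)
  rewrite n<k⇒fallingCoeff≡0 n<k | n<k⇒fallingCoeff≡0 (m<n⇒m<1+n n<k) | ℤP.*-zeroʳ (+ n) = refl

fallingCoeff-suc-zero : ∀ n → fallingCoeff (suc n) 0 ≡ + 0
fallingCoeff-suc-zero zero    = refl
fallingCoeff-suc-zero (suc n) =
  cong ℤ.-_ (trans (cong (+ suc n ℤ.*_) (fallingCoeff-suc-zero n)) (ℤP.*-zeroʳ (+ suc n)))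

fallingCoeff-suc-one : ∀ n → fallingCoeff (suc n) 1 ≡ (ℤ.-1ℤ ℤ.^ n) ℤ.* + (n !)
fallingCoeff-suc-one zero    = refl
fallingCoeff-suc-one (suc n) = begin
  fallingCoeff (suc n) 0 ℤ.- + suc n ℤ.* fallingCoeff (suc n) 1
    ≡⟨ cong₂ (λ a b → a ℤ.- + suc n ℤ.* b) (fallingCoeff-suc-zero n) (fallingCoeff-suc-one n) ⟩
  + 0 ℤ.- + suc n ℤ.* ((ℤ.-1ℤ ℤ.^ n) ℤ.* + (n !))
    ≡⟨ rearrange (+ suc n) (ℤ.-1ℤ ℤ.^ n) (+ (n !)) ⟩
  (ℤ.-1ℤ ℤ.* ℤ.-1ℤ ℤ.^ n) ℤ.* (+ suc n ℤ.* + (n !))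
    ≡⟨ cong ((ℤ.-1ℤ ℤ.* ℤ.-1ℤ ℤ.^ n) ℤ.*_) (ℤP.pos-* (suc n) (n !)) ⟨
  (ℤ.-1ℤ ℤ.* ℤ.-1ℤ ℤ.^ n) ℤ.* + (suc n !) ∎
  where
  rearrange : ∀ m x f → + 0 ℤ.- m ℤ.* (x ℤ.* f) ≡ (ℤ.-1ℤ ℤ.* x) ℤ.* (m ℤ.* f)
  rearrange = ℤ-Solver.solve-∀

signPred-suc : ∀ n → signPred (suc n) ≡ - signPred n
signPred-suc zero    = refl
signPred-suc (suc n) =
  trans (cong toℚ (ℤP.-1*i≡-i (ℤ.-1ℤ ℤ.^ n))) (toℚ-homo‿- (ℤ.-1ℤ ℤ.^ n))

signPred²≡1 : ∀ n → signPred n * signPred n ≡ 1ℚ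
signPred²≡1 zero    = refl
signPred²≡1 (suc n) = begin
  signPred (suc n) * signPred (suc n)  ≡⟨ cong (λ e → e * e) (signPred-suc n) ⟩
  - signPred n * - signPred n          ≡⟨ neg*neg (signPred n) ⟩
  signPred n * signPred n              ≡⟨ signPred²≡1 n ⟩
  1ℚ                                   ∎
  where
  neg*neg : ∀ e → - e * - e ≡ e * e
  neg*neg = solve-∀ ℚ-ring

s[n+1,1]≡signPred*n! : ∀ n → s (suc n) 1 ≡ signPred (suc n) * fromℕ (n !)
s[n+1,1]≡signPred*n! n =
  trans (cong toℚ (fallingCoeff-suc-one n)) (toℚ-homo-* (ℤ.-1ℤ ℤ.^ n) (+ (n !)))

stirlingSum : (ℕ → ℚ) → ℕ → ℚ
stirlingSum F n = sumTo (suc n) (λ k → F k * s n k)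

stirlingSum-cong : ∀ {F F′} n → (∀ k → F k ≡ F′ k) → stirlingSum F n ≡ stirlingSum F′ n
stirlingSum-cong n F≗F′ = sumTo-cong (suc n) (λ k → cong (_* s n k) (F≗F′ k))

stirlingSum-+ : ∀ F F′ n → stirlingSum (λ k → F k + F′ k) n ≡ stirlingSum F n + stirlingSum F′ n
stirlingSum-+ F F′ n =
  trans (sumTo-cong (suc n) (λ k → *-distribʳ-+ (s n k) (F k) (F′ k))) (sumTo-+ (suc n) _ _)

stirlingSum-zero : ∀ F → stirlingSum F 0 ≡ F 0
stirlingSum-zero F = trans (+-identityˡ _) (*-identityʳ (F 0))

stirlingSum-suc : ∀ F n →
  stirlingSum F (suc n) ≡ stirlingSum (F ∘ suc) n - fromℕ n * stirlingSum F n
stirlingSum-suc F n = begin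
  sumTo (suc (suc n)) (λ k → F k * s (suc n) k)
    ≡⟨ sumTo-cong (suc (suc n)) (λ k →
         trans (cong (F k *_) (s-suc n k)) (distrib (F k) (s⁻ n k) (fromℕ n) (s n k))) ⟩
  sumTo (suc (suc n)) (λ k → F k * s⁻ n k - fromℕ n * (F k * s n k))
    ≡⟨ sumTo-- (suc (suc n)) _ _ ⟩
  sumTo (suc (suc n)) (λ k → F k * s⁻ n k) - sumTo (suc (suc n)) (λ k → fromℕ n * (F k * s n k))
    ≡⟨ cong₂ _-_ lowered (trans (sumTo-* (suc (suc n)) (fromℕ n) _) (cong (fromℕ n *_) extended)) ⟩
  stirlingSum (F ∘ suc) n - fromℕ n * stirlingSum F n ∎
  where
  distrib : ∀ f a c b → f * (a - c * b) ≡ f * a - c * (f * b)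
  distrib = solve-∀ ℚ-ring
  lowered : sumTo (suc (suc n)) (λ k → F k * s⁻ n k) ≡ stirlingSum (F ∘ suc) n
  lowered = trans (sumTo-sucˡ (suc n) (λ k → F k * s⁻ n k))
    (trans (cong (_+ stirlingSum (F ∘ suc) n) (*-zeroʳ (F 0)))
           (+-identityˡ (stirlingSum (F ∘ suc) n)))
  extended : sumTo (suc (suc n)) (λ k → F k * s n k) ≡ stirlingSum F n
  extended = trans
    (cong (_+_ (stirlingSum F n))
      (trans (cong (λ a → F (suc n) * toℚ a) (n<k⇒fallingCoeff≡0 {n} ≤-refl))
             (*-zeroʳ (F (suc n)))))
    (+-identityʳ _)

stirlingSum-binomialTransform : ∀ G n →
  stirlingSum (binomialTransform G) (suc n) ≡ stirlingSum (G ∘ suc) n + stirlingSum G n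
stirlingSum-binomialTransform G zero = begin
  stirlingSum (binomialTransform G) 1
    ≡⟨ stirlingSum-suc (binomialTransform G) 0 ⟩
  stirlingSum (binomialTransform G ∘ suc) 0 - 0ℚ * stirlingSum (binomialTransform G) 0
    ≡⟨ drop-zero _ (stirlingSum (binomialTransform G) 0) ⟩
  stirlingSum (binomialTransform G ∘ suc) 0
    ≡⟨ stirlingSum-zero (binomialTransform G ∘ suc) ⟩
  binomialTransform G 1
    ≡⟨ binomialTransform-suc G 0 ⟩
  binomialTransform (G ∘ suc) 0 + binomialTransform G 0
    ≡⟨ cong₂ _+_ (binomialTransform-zero (G ∘ suc)) (binomialTransform-zero G) ⟩
  G 1 + G 0
    ≡⟨ cong₂ _+_ (stirlingSum-zero (G ∘ suc)) (stirlingSum-zero G) ⟨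
  stirlingSum (G ∘ suc) 0 + stirlingSum G 0 ∎
  where
  drop-zero : ∀ a b → a - 0ℚ * b ≡ a
  drop-zero = solve-∀ ℚ-ring
stirlingSum-binomialTransform G (suc m) = begin
  stirlingSum (binomialTransform G) (suc (suc m))
    ≡⟨ stirlingSum-suc (binomialTransform G) (suc m) ⟩
  stirlingSum (binomialTransform G ∘ suc) (suc m)
    - fromℕ (suc m) * stirlingSum (binomialTransform G) (suc m)
    ≡⟨ cong₂ (λ a b → a - fromℕ (suc m) * b)
         (trans (stirlingSum-cong (suc m) (binomialTransform-suc G))
                (stirlingSum-+ (binomialTransform (G ∘ suc)) (binomialTransform G) (suc m)))
         (stirlingSum-binomialTransform G m) ⟩
  stirlingSum (binomialTransform (G ∘ suc)) (suc m) + stirlingSum (binomialTransform G) (suc m)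
    - fromℕ (suc m) * (B₁ + B₀)
    ≡⟨ cong₂ (λ a b → a + b - fromℕ (suc m) * (B₁ + B₀))
         (stirlingSum-binomialTransform (G ∘ suc) m) (stirlingSum-binomialTransform G m) ⟩
  (B₂ + B₁) + (B₁ + B₀) - fromℕ (suc m) * (B₁ + B₀)
    ≡⟨ cong (λ c → (B₂ + B₁) + (B₁ + B₀) - c * (B₁ + B₀)) (fromℕ-suc m) ⟩
  (B₂ + B₁) + (B₁ + B₀) - (1ℚ + fromℕ m) * (B₁ + B₀)
    ≡⟨ regroup B₂ B₁ B₀ (fromℕ m) ⟩
  (B₂ - fromℕ m * B₁) + (B₁ - fromℕ m * B₀)
    ≡⟨ cong₂ _+_ (stirlingSum-suc (G ∘ suc) m) (stirlingSum-suc G m) ⟨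
  stirlingSum (G ∘ suc) (suc m) + stirlingSum G (suc m) ∎
  where
  B₂ = stirlingSum (G ∘ suc ∘ suc) m
  B₁ = stirlingSum (G ∘ suc) m
  B₀ = stirlingSum G m
  regroup : ∀ b₂ b₁ b₀ c →
            (b₂ + b₁) + (b₁ + b₀) - (1ℚ + c) * (b₁ + b₀) ≡ (b₂ - c * b₁) + (b₁ - c * b₀)
  regroup = solve-∀ ℚ-ring

sumTo-twoX* : ∀ m (f : ℕ → ℚ) → sumTo (suc (suc m)) (λ k → twoX k * f k) ≡ twoX 1 * f 1
sumTo-twoX* zero    f = zero-first (f 0) (twoX 1 * f 1)
  where
  zero-first : ∀ a b → (0ℚ + 0ℚ * a) + b ≡ b
  zero-first = solve-∀ ℚ-ring
sumTo-twoX* (suc m) f =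
  trans (cong₂ _+_ (sumTo-twoX* m f) (*-zeroˡ (f (suc (suc m))))) (+-identityʳ _)

stirlingSum-genocchi : ∀ G → IsGenocchi G → ∀ n →
  stirlingSum G (suc n) + stirlingSum G (suc n) + fromℕ (suc n) * stirlingSum G n
    ≡ twoX 1 * s (suc n) 1
stirlingSum-genocchi G isG n = begin
  X + X + fromℕ (suc n) * Z
    ≡⟨ cong₂ (λ x c → X + x + c * Z) (stirlingSum-suc G n) (fromℕ-suc n) ⟩
  X + (Y - fromℕ n * Z) + (1ℚ + fromℕ n) * Z
    ≡⟨ regroup X Y Z (fromℕ n) ⟩
  (Y + Z) + X
    ≡⟨ cong (_+ X) (stirlingSum-binomialTransform G n) ⟨
  stirlingSum (binomialTransform G) (suc n) + X
    ≡⟨ stirlingSum-+ (binomialTransform G) G (suc n) ⟨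
  stirlingSum (λ k → binomialTransform G k + G k) (suc n)
    ≡⟨ stirlingSum-cong (suc n) (binomialTransform-genocchi G isG) ⟩
  stirlingSum twoX (suc n)
    ≡⟨ sumTo-twoX* n (s (suc n)) ⟩
  twoX 1 * s (suc n) 1 ∎
  where
  X = stirlingSum G (suc n)
  Y = stirlingSum (G ∘ suc) n
  Z = stirlingSum G n
  regroup : ∀ x y z c → x + (y - c * z) + (1ℚ + c) * z ≡ (y + z) + x
  regroup = solve-∀ ℚ-ring

x+x+cz≡2e′f⇒c½ez+f≡e′x : ∀ {e e′ f c z x} → e′ ≡ - e → e * e ≡ 1ℚ →
  x + x + c * z ≡ twoX 1 * (e′ * f) → c * ½ * (e * z) + f ≡ e′ * x
x+x+cz≡2e′f⇒c½ez+f≡e′x {e} {_} {f} {c} {z} {x} refl e²≡1 twice = begin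
  c * ½ * (e * z) + f
    ≡⟨ expand e f c z ⟩
  ½ * - e * (twoX 1 * (- e * f) - c * z) + f * (1ℚ - e * e)
    ≡⟨ cong₂ (λ a b → ½ * - e * (a - c * z) + f * (1ℚ - b)) (sym twice) e²≡1 ⟩
  ½ * - e * (x + x + c * z - c * z) + f * (1ℚ - 1ℚ)
    ≡⟨ collapse e f c z x ⟩
  - e * x ∎
  where
  expand : ∀ e f c z →
           c * ½ * (e * z) + f ≡ ½ * - e * (twoX 1 * (- e * f) - c * z) + f * (1ℚ - e * e)
  expand = solve-∀ ℚ-ring
  collapse : ∀ e f c z x → ½ * - e * (x + x + c * z - c * z) + f * (1ℚ - 1ℚ) ≡ - e * x
  collapse = solve-∀ ℚ-ring

theorem1 : (G : ℕ → ℚ) → IsGenocchi G →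
    ∀ n → seqA n ≡ signPred n * sumTo (suc n) (λ k → G k * toℚ (stirling1 n k))
theorem1 G isG zero    = sym (cong (λ g → signPred 0 * (0ℚ + g * s 0 0)) (genocchi-zero G isG))
theorem1 G isG (suc n) = begin
  (+ suc n / 2) * seqA n + fromℕ (n !)
    ≡⟨ cong₂ (λ c a → c * a + fromℕ (n !)) (a/n≡a*1/n (+ suc n) 2) (theorem1 G isG n) ⟩
  fromℕ (suc n) * ½ * (signPred n * stirlingSum G n) + fromℕ (n !)
    ≡⟨ x+x+cz≡2e′f⇒c½ez+f≡e′x {c = fromℕ (suc n)} {z = stirlingSum G n}
         (signPred-suc n) (signPred²≡1 n)
         (trans (stirlingSum-genocchi G isG n) (cong (twoX 1 *_) (s[n+1,1]≡signPred*n! n))) ⟩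
  signPred (suc n) * stirlingSum G (suc n) ∎
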